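{- Let $\mathcal C$ be a coherent configuration with fibers $X_1,\dots,X_f$, adjacency algebra $\mathfrak A=\bigoplus_{s\in S}\mathfrak C_s$, and fix $s\in S$ and a basis of matrix units $\{\varepsilon^s_{i,j}:i,j\in F_s\}$ for $\mathfrak C_s$. Define $\eta(i,j,s)=(k,l)$ if $\varepsilon^s_{i,j}\in\mathfrak A_{k,l}$, let $\Lambda_s=F_s^2\times\{s\}$, and let $F'_s=\{k\in\{1,\dots,f\}:(k,k)\in\{\eta(i,i,s):i\in F_s\}\}$. Then $\eta(\Lambda_s)=F_s'^2$.
   Context: A coherent configuration consists of a finite set $X$ partitioned into fibers $X=\bigsqcup_{i=1}^f X_i$ and, for each $i,j$, a partition $X_i\times X_j=\bigsqcup_{k}R_{i,j,k}$, whose $0/1$ adjacency matrices $A_I\in M_X(\mathbb C)$ satisfy: each fiber's identity (diagonal $0/1$ matrix supported on $\{(x,x):x\in X_i\}$) is some $A_I$; $\sum_I A_I$ is the all-ones matrix; transposes of the $A_I$ are again among the $A_I$; products $A_IA_J$ are linear combinations of the $A_K$. The adjacency algebra $\mathfrak A=\mathrm{span}\{A_I\}$ is semisimple and closed under ${}^*$. $\mathfrak A_{k,l}$ is the subspace of matrices in $\mathfrak A$ whose entries outside $X_k\times X_l$ vanish (these subspaces intersect trivially, so $\eta$ is well defined on nonzero elements). $\mathfrak A=\bigoplus_{s\in S}\mathfrak C_s$ is the decomposition into simple two-sided ideals, $\mathfrak C_s\cong M_{e_s}(\mathbb C)$. A basis of matrix units for $\mathfrak C_s$ is a basis $\{\varepsilon^s_{i,j}:i,j\in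 F_s\}$ of $\mathfrak C_s$, $|F_s|=e_s$, with $\varepsilon^s_{i,j}\varepsilon^s_{k,l}=\delta_{j,k}\varepsilon^s_{i,l}$, $(\varepsilon^s_{i,j})^*=\varepsilon^s_{j,i}$, and each $\varepsilon^s_{i,j}$ lying in $\mathfrak A_{k,l}$ for some $k,l$. -}

module Defs where

open import Level using (0ℓ)
open import Data.Nat using (ℕ)
open import Data.Fin as F using (Fin)
open import Data.Product using (Σ; ∃; ∃-syntax; _×_; _,_)
open import Data.Sum using (_⊎_)
open import Relation.Nullary using (¬_)
import Relation.Nullary
open import Relation.Binary.PropositionalEquality using (_≡_; _≢_)
open import Algebra.Bundles using (CommutativeRing)

-- The scalar field.  agda-stdlib has no complex numbers, so we work over
-- an arbitrary field K equipped with an involutive automorphism conj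
-- (the role of complex conjugation).

record InvField : Set₁ where
  field
    commRing : CommutativeRing 0ℓ 0ℓ
  open CommutativeRing commRing public
  field
    1≉0     : ¬ (1# ≈ 0#)
    inverse : ∀ x → ¬ (x ≈ 0#) → ∃[ y ] (x * y ≈ 1#)
    conj       : Carrier → Carrier
    conj-cong  : ∀ {x y} → x ≈ y → conj x ≈ conj y
    conj-+     : ∀ x y → conj (x + y) ≈ conj x + conj y
    conj-*     : ∀ x y → conj (x * y) ≈ conj x * conj y
    conj-1     : conj 1# ≈ 1#
    conj-invol : ∀ x → conj (conj x) ≈ x

module Matrices (K : InvField) where
  open InvField K using (Carrier; _≈_; _+_; _*_; 0#; 1#; conj)

  ∑ : ∀ {n} → (Fin n → Carrier) → Carrier
  ∑ {ℕ.zero}  g = 0#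
  ∑ {ℕ.suc n} g = g F.zero + ∑ (λ i → g (F.suc i))

  Mat : ℕ → Set
  Mat n = Fin n → Fin n → Carrier

  _≈M_ : ∀ {n} → Mat n → Mat n → Set
  M ≈M N = ∀ x y → M x y ≈ N x y

  0M : ∀ {n} → Mat n
  0M x y = 0#

  _+M_ : ∀ {n} → Mat n → Mat n → Mat n
  (M +M N) x y = M x y + N x y

  _•_ : ∀ {n} → Carrier → Mat n → Mat n
  (a • M) x y = a * M x y

  _·_ : ∀ {n} → Mat n → Mat n → Mat n
  (M · N) x y = ∑ (λ z → M x z * N z y)

  _* : ∀ {n} → Mat n → Mat n
  (M *) x y = conj (M y x)

  lin : ∀ {n m} → (Fin m → Carrier) → (Fin m → Mat n) → Mat n
  lin c M x y = ∑ (λ i → c i * M i x y)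

  record IsSubspace {n} (P : Mat n → Set) : Set where
    field
      resp  : ∀ {M N} → M ≈M N → P M → P N
      has0  : P 0M
      plus  : ∀ {M N} → P M → P N → P (M +M N)
      scale : ∀ a {M} → P M → P (a • M)

module Coherent (K : InvField) where
  open InvField K using (Carrier; _≈_; _+_; _*_; 0#; 1#; conj)
  open Matrices K public

  adj : ∀ {n r} → (Fin n → Fin n → Fin r) → Fin r → Mat n
  adj rel I x y with rel x y F.≟ I
  ... | Relation.Nullary.yes _ = 1#
  ... | Relation.Nullary.no  _ = 0#

  record CoherentConfiguration (n f r : ℕ) : Set where
    field
      -- the fiber of each point; X_i = { x | fiber x ≡ i }, each X_i nonempty
      fiber         : Fin n → Fin f
      fiber-nonempty : ∀ i → ∃[ x ] (fiber x ≡ i)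
      -- rel x y = the unique basis relation R_I containing (x , y)
      rel           : Fin n → Fin n → Fin r
      rel-nonempty  : ∀ I → ∃[ x ] ∃[ y ] (rel x y ≡ I)
      rel-fibers    : ∀ I → ∃[ i ] ∃[ j ] (∀ x y → rel x y ≡ I → fiber x ≡ i × fiber y ≡ j)

      -- each fiber's identity is some A_I
      fiber-identity : ∀ i → ∃[ I ] (∀ x y → (rel x y ≡ I → x ≡ y × fiber x ≡ i)
                                         × (x ≡ y → fiber x ≡ i → rel x y ≡ I))
      transpose : ∀ I → ∃[ J ] (∀ x y → (rel y x ≡ I → rel x y ≡ J) × (rel x y ≡ J → rel y x ≡ I))
      product : ∀ I J → Σ (Fin r → Carrier) λ c → ((adj rel I · adj rel J) ≈M lin c (adj rel))

  module Config {n f r} (𝒞 : CoherentConfiguration n f r) where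
    open CoherentConfiguration 𝒞 public

    A : Fin r → Mat n
    A = adj rel

    In𝔄 : Mat n → Set
    In𝔄 M = Σ (Fin r → Carrier) λ c → (M ≈M lin c A)

    In𝔄kl : Fin f → Fin f → Mat n → Set
    In𝔄kl k l M = In𝔄 M × (∀ x y → ¬ (fiber x ≡ k × fiber y ≡ l) → M x y ≈ 0#)

    record IsIdeal (P : Mat n → Set) : Set where
      field
        subspace : IsSubspace P
        ⊆𝔄      : ∀ {M} → P M → In𝔄 M
        left     : ∀ {M N} → In𝔄 M → P N → P (M · N)
        right    : ∀ {M N} → P M → In𝔄 N → P (M · N)

    record IsSimpleIdeal (P : Mat n → Set) : Set₁ where
      field
        ideal   : IsIdeal P
        nonzero : Σ (Mat n) λ M → (P M × ¬ (M ≈M 0M))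
        minimal : ∀ (Q : Mat n → Set) → IsIdeal Q → (∀ {M} → Q M → P M) →
                  (∀ {M} → Q M → M ≈M 0M) ⊎ (∀ {M} → P M → Q M)

    record IsSimpleDecomposition {m} (C : Fin m → Mat n → Set) : Set₁ where
      field
        simple : ∀ s → IsSimpleIdeal (C s)
        span   : ∀ {M} → In𝔄 M → Σ (Fin m → Mat n) λ N → ((∀ s → C s (N s)) × (M ≈M (λ x y → ∑ (λ s → N s x y))))
        direct : ∀ (N : Fin m → Mat n) → (∀ s → C s (N s)) →
                 (λ x y → ∑ (λ s → N s x y)) ≈M 0M → ∀ s → N s ≈M 0M

    record IsMatrixUnitBasis {e} (P : Mat n → Set) (ε : Fin e → Fin e → Mat n) : Set where
      field
        member   : ∀ i j → P (ε i j)
        spanning : ∀ {M} → P M → Σ (Fin e → Fin e → Carrier) λ c → (M ≈M (λ x y → ∑ (λ i → ∑ (λ j → c i j * ε i j x y))))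
        indep    : ∀ (c : Fin e → Fin e → Carrier) →
                   (λ x y → ∑ (λ i → ∑ (λ j → c i j * ε i j x y))) ≈M 0M → ∀ i j → c i j ≈ 0#
        mult-eq  : ∀ i j k l → j ≡ k → (ε i j · ε k l) ≈M ε i l
        mult-neq : ∀ i j k l → j ≢ k → (ε i j · ε k l) ≈M 0M
        star     : ∀ i j → (ε i j *) ≈M ε j i
        blocks   : ∀ i j → ∃[ k ] ∃[ l ] In𝔄kl k l (ε i j)

    -- η(i,j,s) = (k,l), expressed as a relation:  η-is i j k l  iff  ε_{i,j} ∈ 𝔄_{k,l}
    module _ {e} (ε : Fin e → Fin e → Mat n) where
      η-is : Fin e → Fin e → Fin f → Fin f → Set
      η-is i j k l = In𝔄kl k l (ε i j)

      F′ : Fin f → Set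
      F′ k = ∃[ i ] η-is i i k k

module Submission where

-- Say M "lives in rows k" if M x y = 0 whenever x ∉ X_k, and "in
-- columns l" similarly; M ∈ 𝔄_{k,l} iff M ∈ 𝔄 and M lives in rows k and
-- columns l.  Row support survives multiplication on the right, column
-- support on the left, and the conjugate transpose exchanges the two.
-- Since ε_ii = ε_ij ε_ji = ε_ij ε_ij* and ε_jj = ε_ij* ε_ij, an ε_ij in
-- 𝔄_{k,l} forces ε_ii ∈ 𝔄_{k,k} and ε_jj ∈ 𝔄_{l,l}, i.e. k, l ∈ F'_s.
-- Conversely ε_ij = ε_ii ε_ij = ε_ij ε_jj, so ε_ii ∈ 𝔄_{k,k} and
-- ε_jj ∈ 𝔄_{l,l} put ε_ij in 𝔄_{k,l}.

open import Defs
open import Data.Nat using (zero; suc)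
open import Data.Fin using (Fin; zero; suc; _≟_)
open import Data.Empty using (⊥-elim)
open import Data.Product using (∃-syntax; _×_; _,_; proj₁; proj₂)
open import Relation.Nullary using (¬_; yes; no)
open import Relation.Binary.PropositionalEquality using (_≡_; _≢_; refl)
open import Algebra.Properties.Ring using (x+x≈x⇒x≈0)

module Support (K : InvField) where
  open InvField K hiding (refl; zero)
  open Coherent K
  open import Relation.Binary.Reasoning.Setoid setoid

  ∑-zero : ∀ {p} (g : Fin p → Carrier) → (∀ z → g z ≈ 0#) → ∑ g ≈ 0#
  ∑-zero {zero}  g g≈0 = InvField.refl K
  ∑-zero {suc p} g g≈0 =
    trans (+-cong (g≈0 zero) (∑-zero (λ i → g (suc i)) (λ z → g≈0 (suc z))))
          (+-identityˡ 0#)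

  conj-0 : conj 0# ≈ 0#
  conj-0 = x+x≈x⇒x≈0 ring (conj 0#) (begin
    conj 0# + conj 0# ≈⟨ sym (conj-+ 0# 0#) ⟩
    conj (0# + 0#)    ≈⟨ conj-cong (+-identityˡ 0#) ⟩
    conj 0#           ∎)

  module _ {n f} (fiber : Fin n → Fin f) where

    RowsIn : Fin f → Mat n → Set
    RowsIn k M = ∀ x y → fiber x ≢ k → M x y ≈ 0#

    ColsIn : Fin f → Mat n → Set
    ColsIn l M = ∀ x y → fiber y ≢ l → M x y ≈ 0#

    BlockIn : Fin f → Fin f → Mat n → Set
    BlockIn k l M = ∀ x y → ¬ (fiber x ≡ k × fiber y ≡ l) → M x y ≈ 0#

    block⇒rows : ∀ {k l M} → BlockIn k l M → RowsIn k M
    block⇒rows M∈kl x y x∉k = M∈kl x y (λ x∈k,y∈l → x∉k (proj₁ x∈k,y∈l))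

    block⇒cols : ∀ {k l M} → BlockIn k l M → ColsIn l M
    block⇒cols M∈kl x y y∉l = M∈kl x y (λ x∈k,y∈l → y∉l (proj₂ x∈k,y∈l))

    rows×cols⇒block : ∀ {k l M} → RowsIn k M → ColsIn l M → BlockIn k l M
    rows×cols⇒block {k} {l} rows cols x y x,y∉kl with fiber x ≟ k | fiber y ≟ l
    ... | no x∉k  | _        = rows x y x∉k
    ... | yes _   | no y∉l   = cols x y y∉l
    ... | yes x∈k | yes y∈l  = ⊥-elim (x,y∉kl (x∈k , y∈l))

    rowsIn-resp : ∀ {k M N} → M ≈M N → RowsIn k M → RowsIn k N
    rowsIn-resp M≈N rows x y x∉k = trans (sym (M≈N x y)) (rows x y x∉k)

    colsIn-resp : ∀ {l M N} → M ≈M N → ColsIn l M → ColsIn l N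
    colsIn-resp M≈N cols x y y∉l = trans (sym (M≈N x y)) (cols x y y∉l)

    rowsIn-·ʳ : ∀ {k M} N → RowsIn k M → RowsIn k (M · N)
    rowsIn-·ʳ N rows x y x∉k = ∑-zero _ (λ z → trans (*-congʳ (rows x z x∉k)) (zeroˡ _))

    colsIn-·ˡ : ∀ {l} M {N} → ColsIn l N → ColsIn l (M · N)
    colsIn-·ˡ M cols x y y∉l = ∑-zero _ (λ z → trans (*-congˡ (cols z y y∉l)) (zeroʳ _))

    rowsIn-* : ∀ {k M N} → (M *) ≈M N → RowsIn k M → ColsIn k N
    rowsIn-* M*≈N rows x y y∉k = trans (sym (M*≈N x y)) (trans (conj-cong (rows y x y∉k)) conj-0)

    colsIn-* : ∀ {k M N} → (M *) ≈M N → ColsIn k M → RowsIn k N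
    colsIn-* M*≈N cols x y x∉k = trans (sym (M*≈N x y)) (trans (conj-cong (cols y x x∉k)) conj-0)

module MatrixUnitBlocks (K : InvField) {n f r} (𝒞 : Coherent.CoherentConfiguration K n f r) where
  open Coherent K
  open Config 𝒞
  open Support K

  module _ {P : Mat n → Set} {e} {ε : Fin e → Fin e → Mat n} (units : IsMatrixUnitBasis P ε) where
    open IsMatrixUnitBasis units

    unit∈𝔄 : ∀ i j → In𝔄 (ε i j)
    unit∈𝔄 i j = proj₁ (proj₂ (proj₂ (blocks i j)))

    unit-block : ∀ i j {k l} → RowsIn fiber k (ε i j) → ColsIn fiber l (ε i j) → In𝔄kl k l (ε i j)
    unit-block i j rows cols = unit∈𝔄 i j , rows×cols⇒block fiber rows cols

    -- ε_ij ∈ 𝔄_{k,l} gives ε_ii = ε_ij ε_ij* ∈ 𝔄_{k,k}.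
    diagonal-of-row : ∀ i j {k l} → In𝔄kl k l (ε i j) → In𝔄kl k k (ε i i)
    diagonal-of-row i j (_ , ij∈kl) = unit-block i i
      (rowsIn-resp fiber (mult-eq i j j i refl) (rowsIn-·ʳ fiber (ε j i) ij-rows))
      (colsIn-resp fiber (mult-eq i j j i refl) (colsIn-·ˡ fiber (ε i j) (rowsIn-* fiber (star i j) ij-rows)))
      where ij-rows = block⇒rows fiber ij∈kl

    -- ε_ij ∈ 𝔄_{k,l} gives ε_jj = ε_ij* ε_ij ∈ 𝔄_{l,l}.
    diagonal-of-col : ∀ i j {k l} → In𝔄kl k l (ε i j) → In𝔄kl l l (ε j j)
    diagonal-of-col i j (_ , ij∈kl) = unit-block j j
      (rowsIn-resp fiber (mult-eq j i i j refl) (rowsIn-·ʳ fiber (ε i j) (colsIn-* fiber (star i j) ij-cols)))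
      (colsIn-resp fiber (mult-eq j i i j refl) (colsIn-·ˡ fiber (ε j i) ij-cols))
      where ij-cols = block⇒cols fiber ij∈kl

    -- ε_ii ∈ 𝔄_{k,k} and ε_jj ∈ 𝔄_{l,l} give ε_ij = ε_ii ε_ij = ε_ij ε_jj ∈ 𝔄_{k,l}.
    off-diagonal : ∀ i j {k l} → In𝔄kl k k (ε i i) → In𝔄kl l l (ε j j) → In𝔄kl k l (ε i j)
    off-diagonal i j (_ , ii∈kk) (_ , jj∈ll) = unit-block i j
      (rowsIn-resp fiber (mult-eq i i i j refl) (rowsIn-·ʳ fiber (ε i j) (block⇒rows fiber ii∈kk)))
      (colsIn-resp fiber (mult-eq i j j j refl) (colsIn-·ˡ fiber (ε i j) (block⇒cols fiber jj∈ll)))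

lemma2p7 : (K : InvField) → let open Coherent K in
    ∀ {n f r} (𝒞 : CoherentConfiguration n f r) → let open Config 𝒞 in
    ∀ {m} (C : Fin m → Mat n → Set) → IsSimpleDecomposition C →
    ∀ (s : Fin m) {e} (ε : Fin e → Fin e → Mat n) → IsMatrixUnitBasis (C s) ε →
    -- η(Λ_s) ⊆ F'_s × F'_s
    (∀ i j k l → η-is ε i j k l → F′ ε k × F′ ε l)
    -- F'_s × F'_s ⊆ η(Λ_s)
    × (∀ k l → F′ ε k → F′ ε l → ∃[ i ] ∃[ j ] η-is ε i j k l)
lemma2p7 K 𝒞 C _ s ε units = η-into-F′² , F′²-into-η
  where
  open Coherent K
  open Config 𝒞
  open MatrixUnitBlocks K 𝒞

  η-into-F′² : ∀ i j k l → η-is ε i j k l → F′ ε k × F′ ε l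
  η-into-F′² i j k l ij∈kl = (i , diagonal-of-row units i j ij∈kl) , (j , diagonal-of-col units i j ij∈kl)

  F′²-into-η : ∀ k l → F′ ε k → F′ ε l → ∃[ i ] ∃[ j ] η-is ε i j k l
  F′²-into-η k l (i , ii∈kk) (j , jj∈ll) = i , j , off-diagonal units i j ii∈kk jj∈ll
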